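{- For each positive integer $d$, $r_d\colon\mathbb{N}^d\to\mathbb{N}$ is a $d$-tupling function (a bijection from $\mathbb{N}^d$ to $\mathbb{N}$), and its inverse is the function $r_d^{ -1}\colon\mathbb{N}\to\mathbb{N}^d$ given by the recursive formula in the context.
   Context: $\mathbb{N}$ denotes the set of non-negative integers. The Rosenberg-Strong $d$-tupling function $r_d\colon\mathbb{N}^d\to\mathbb{N}$ is defined by $r_1(x_1)=x_1$ and, for $d>1$, $r_d(x_1,\ldots,x_{d-1},x_d)=r_{d-1}(x_1,\ldots,x_{d-1})+m^d+(m-x_d)\bigl((m+1)^{d-1}-m^{d-1}\bigr)$ with $m=\max(x_1,\ldots,x_d)$. The formula $r_d^{ -1}$ is defined recursively by $r_1^{ -1}(z)=z$ and, for integers $d>1$, $r_d^{ -1}(z)=\Bigl(r_{d-1}^{ -1}\bigl(z-m^d-(m-x_d)((m+1)^{d-1}-m^{d-1})\bigr),\,x_d\Bigr)$, where $m=\lfloor\sqrt[d]{z}\rfloor$ and $x_d=m-\left\lfloor\frac{\max(0,\,z-m^d-m^{d-1})}{(m+1)^{d-1}-m^{d-1}}\right\rfloor$; here $(\mathbf{v},x_d)$ with $\mathbf{v}=(v_1,\ldots,v_{d-1})$ denotes $(v_1,\ldots,v_{d-1},x_d)$. -}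

module Defs where

open import Data.Nat using (ℕ; zero; suc; _+_; _*_; _∸_; _^_; _⊔_; _≤?_)
open import Data.Nat.DivMod using (_/_)
open import Data.Vec using (Vec; []; _∷_; _∷ʳ_; init; last; foldr)
open import Relation.Nullary using (does)
open import Data.Bool using (if_then_else_)

rootSearch : ℕ → ℕ → ℕ → ℕ
rootSearch d z zero = zero
rootSearch d z (suc k) = if does (suc k ^ d ≤? z) then suc k else rootSearch d z k

-- ⌊ z^(1/d) ⌋ for d ≥ 1 (the root is ≤ z, so searching below z suffices)
iroot : ℕ → ℕ → ℕ
iroot d z = rootSearch d z z

-- natural-number floor division; the divisor is never 0 where it is used
divℕ : ℕ → ℕ → ℕ
divℕ a zero = zero
divℕ a (suc b) = a / suc b

maxV : ∀ {k} → Vec ℕ k → ℕ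
maxV = foldr _ _⊔_ 0

-- Rosenberg–Strong tupling r_d with d = suc n, on ℕ^d = Vec ℕ d
r : (n : ℕ) → Vec ℕ (suc n) → ℕ
r zero (x ∷ []) = x
r (suc n) v =
  let d = suc (suc n)
      m = maxV v
      xd = last v
  in r n (init v) + m ^ d + (m ∸ xd) * ((suc m) ^ (suc n) ∸ m ^ (suc n))

rinv : (n : ℕ) → ℕ → Vec ℕ (suc n)
rinv zero z = z ∷ []
rinv (suc n) z =
  let d = suc (suc n)
      m = iroot d z
      δ = (suc m) ^ (suc n) ∸ m ^ (suc n)
      xd = m ∸ divℕ (z ∸ m ^ d ∸ m ^ (suc n)) δ
  in rinv n (z ∸ m ^ d ∸ (m ∸ xd) * δ) ∷ʳ xd

module Submission where

-- Call [m^e, (m+1)^e) the e-th shell of m.  The argument rests on three facts.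
--  * The e-th shells are disjoint, and ⌊z^(1/e)⌋ (iroot) names the one containing z.
--  * Writing g = (m+1)^e − m^e, the (e+1)-st shell of m has width m^e + (m+1)·g.
--  * r n v lies in the (n+1)-st shell of the maximum of v (r-shell), because
--    r (u ∷ʳ x) = r u + M^(n+2) + (M − x)·g with M = max (maxV u) x.
-- Left inverse (rinv∘r), by induction on n: the code of u ∷ʳ x lies in the shell
-- of M, so rinv finds M as its root, M − x as a quotient by g (encode-digit), and
-- r u as the remainder.  Right inverse (r∘rinv), by induction on n: for z in the
-- shell of m, the module Decoding splits z into m^(n+2), a multiple k·g and a
-- remainder below (m+1)^(n+1) (and above m^(n+1) when k > 0); the tuple decoded
-- from the remainder, extended by m − k, then has maximum m and re-encodes to z.

open import Defs
open import Data.Nat using (ℕ; zero; suc; _+_; _*_; _∸_; _^_; _⊔_; _≤_; _<_; _≤?_; _≟_;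
  z≤n; s≤s; s≤s⁻¹; >-nonZero; ≢-nonZero)
open import Data.Nat.Properties
open import Data.Nat.DivMod using (_/_; _%_; +-distrib-/; m<n⇒m%n≡m; m*n%n≡0; m<n⇒m/n≡0;
  m*n/n≡m; m/n*n≤m; m%n≡m∸m/n*n; m%n<n; m<n*o⇒m/o<n)
open import Data.Vec using (Vec; []; _∷_; _∷ʳ_; initLast)
open import Data.Vec.Properties using (init-∷ʳ; last-∷ʳ)
open import Data.Product using (_×_; _,_; proj₁; proj₂)
open import Data.Sum using (_⊎_; inj₁; inj₂; map₂)
open import Data.Bool using (if_then_else_)
open import Relation.Nullary using (¬_; yes; no)
open import Relation.Nullary.Decidable using (dec-true; dec-false)
open import Relation.Nullary.Negation using (contradiction)
open import Relation.Binary.PropositionalEquality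

-- gap m e = (m+1)^e − m^e, the number of e-tuples whose maximum is exactly m
gap : ℕ → ℕ → ℕ
gap m e = suc m ^ e ∸ m ^ e

pow+gap : ∀ m e → m ^ e + gap m e ≡ suc m ^ e
pow+gap m e = m+[n∸m]≡n (^-monoˡ-≤ e (n≤1+n m))

gap>0 : ∀ m e → 0 < gap m (suc e)
gap>0 m e = m<n⇒0<n∸m (^-monoˡ-< (suc e) (n<1+n m))

shell-width : ∀ m e → suc m ^ suc e ≡ m ^ suc e + (m ^ e + suc m * gap m e)
shell-width m e = begin
  suc m * suc m ^ e                  ≡⟨ cong (suc m *_) (sym (pow+gap m e)) ⟩
  suc m * (m ^ e + g)                ≡⟨ *-distribˡ-+ (suc m) (m ^ e) g ⟩
  (m ^ e + m * m ^ e) + suc m * g    ≡⟨ cong (_+ suc m * g) (+-comm (m ^ e) (m * m ^ e)) ⟩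
  (m * m ^ e + m ^ e) + suc m * g    ≡⟨ +-assoc (m * m ^ e) (m ^ e) (suc m * g) ⟩
  m * m ^ e + (m ^ e + suc m * g)    ∎
  where
  open ≡-Reasoning
  g : ℕ
  g = gap m e

^-reflects-< : ∀ e {b c} → b ^ e < c ^ e → b < c
^-reflects-< e {b} {c} b^e<c^e with b <? c
... | yes b<c = b<c
... | no  b≮c = contradiction (^-monoˡ-≤ e (≮⇒≥ b≮c)) (<⇒≱ b^e<c^e)

∸-<-bound : ∀ {y A B} → 0 < B → y < A + B → y ∸ A < B
∸-<-bound {y} {A} 0<B y< = m<n+o⇒m∸n<o y A {{>-nonZero 0<B}} y<

cancel-middle : ∀ R A K → R + A + K ∸ A ≡ R + K
cancel-middle R A K = begin
  R + A + K ∸ A    ≡⟨ cong (_∸ A) (+-assoc R A K) ⟩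
  R + (A + K) ∸ A  ≡⟨ cong (λ t → R + t ∸ A) (+-comm A K) ⟩
  R + (K + A) ∸ A  ≡⟨ cong (_∸ A) (sym (+-assoc R K A)) ⟩
  R + K + A ∸ A    ≡⟨ m+n∸n≡m (R + K) A ⟩
  R + K            ∎
  where open ≡-Reasoning

Shell : ℕ → ℕ → ℕ → Set
Shell e m z = m ^ e ≤ z × z < suc m ^ e

shell-≤ : ∀ e {b m z} → b ^ e ≤ z → z < suc m ^ e → b ≤ m
shell-≤ e lo hi = s≤s⁻¹ (^-reflects-< e (≤-<-trans lo hi))

shell-unique : ∀ e {m m′ z} → Shell e m z → Shell e m′ z → m ≡ m′
shell-unique e (lo , hi) (lo′ , hi′) = ≤-antisym (shell-≤ e lo hi′) (shell-≤ e lo′ hi)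

below-next-shell : ∀ e {a R} M → a ≤ M → R < suc a ^ e → R < M ^ e + gap M e
below-next-shell e {a} M a≤M R< = begin-strict
  _              <⟨ R< ⟩
  suc a ^ e      ≤⟨ ^-monoˡ-≤ e (s≤s a≤M) ⟩
  suc M ^ e      ≡⟨ sym (pow+gap M e) ⟩
  M ^ e + gap M e ∎
  where open ≤-Reasoning

rootSearch-hit : ∀ d z k → suc k ^ d ≤ z → rootSearch d z (suc k) ≡ suc k
rootSearch-hit d z k p = cong (if_then suc k else rootSearch d z k) (dec-true (suc k ^ d ≤? z) p)

rootSearch-miss : ∀ d z k → ¬ (suc k ^ d ≤ z) → rootSearch d z (suc k) ≡ rootSearch d z k
rootSearch-miss d z k ¬p = cong (if_then suc k else rootSearch d z k) (dec-false (suc k ^ d ≤? z) ¬p)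

rootSearch-shell : ∀ d z k → z < suc k ^ suc d → Shell (suc d) (rootSearch (suc d) z k) z
rootSearch-shell d z zero    z< = z≤n , z<
rootSearch-shell d z (suc k) z< with suc k ^ suc d ≤? z
... | yes p = subst (λ m → Shell (suc d) m z) (sym (rootSearch-hit (suc d) z k p)) (p , z<)
... | no ¬p = subst (λ m → Shell (suc d) m z) (sym (rootSearch-miss (suc d) z k ¬p))
                (rootSearch-shell d z k (≰⇒> ¬p))

iroot-shell : ∀ d z → Shell (suc d) (iroot (suc d) z) z
iroot-shell d z = rootSearch-shell d z z (<-≤-trans (n<1+n z) (m≤m*n (suc z) (suc z ^ d) {{m^n≢0 (suc z) d}}))

iroot-unique : ∀ d {m z} → Shell (suc d) m z → iroot (suc d) z ≡ m
iroot-unique d {z = z} sh = shell-unique (suc d) (iroot-shell d z) sh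

divℕ-exact : ∀ t k D → t < D → divℕ (t + k * D) D ≡ k
divℕ-exact t k D@(suc _) t<D = begin
  (t + k * D) / D    ≡⟨ +-distrib-/ t (k * D) remainders< ⟩
  t / D + k * D / D  ≡⟨ cong₂ _+_ (m<n⇒m/n≡0 t<D) (m*n/n≡m k D) ⟩
  k                  ∎
  where
  open ≡-Reasoning
  remainders< : t % D + k * D % D < D
  remainders< = subst (_< D) (sym (trans (cong₂ _+_ (m<n⇒m%n≡m t<D) (m*n%n≡0 k D)) (+-identityʳ t))) t<D

divℕ-*≤ : ∀ q D → divℕ q D * D ≤ q
divℕ-*≤ q zero    = z≤n
divℕ-*≤ q (suc b) = m/n*n≤m q (suc b)

divℕ-remainder< : ∀ q D → 0 < D → q ∸ divℕ q D * D < D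
divℕ-remainder< q D@(suc _) _ = subst (_< D) (m%n≡m∸m/n*n q D) (m%n<n q D)

divℕ-< : ∀ q D k → q < k * D → divℕ q D < k
divℕ-< q zero    k q<0 = contradiction (subst (q <_) (*-zeroʳ k) q<0) (λ ())
divℕ-< q (suc b) k q<  = m<n*o⇒m/o<n q<

∷ʳ-elim : ∀ {a n} {A : Set a} (P : Vec A (suc n) → Set) → (∀ u x → P (u ∷ʳ x)) → ∀ v → P v
∷ʳ-elim P step v with initLast v
... | u , x , refl = step u x

maxV-∷ʳ : ∀ {k} (u : Vec ℕ k) x → maxV (u ∷ʳ x) ≡ maxV u ⊔ x
maxV-∷ʳ []      x = ⊔-identityʳ x
maxV-∷ʳ (a ∷ u) x = trans (cong (a ⊔_) (maxV-∷ʳ u x)) (sym (⊔-assoc a (maxV u) x))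

r-∷ʳ : ∀ n (u : Vec ℕ (suc n)) x → let M = maxV u ⊔ x in
  r (suc n) (u ∷ʳ x) ≡ r n u + M ^ suc (suc n) + (M ∸ x) * gap M (suc n)
r-∷ʳ n u x rewrite init-∷ʳ x u | last-∷ʳ x u | maxV-∷ʳ u x = refl

encode-shell : ∀ e {a R} x → Shell e a R → let M = a ⊔ x in
  Shell (suc e) M (R + M ^ suc e + (M ∸ x) * gap M e)
encode-shell e {a} {R} x (_ , R<) = ≤-trans (m≤n+m _ R) (m≤m+n _ _) , code<
  where
  open ≤-Reasoning
  M D : ℕ
  M = a ⊔ x
  D = gap M e
  code< : R + M ^ suc e + (M ∸ x) * D < suc M ^ suc e
  code< = begin-strict
    R + M ^ suc e + (M ∸ x) * D      ≡⟨ cong (_+ (M ∸ x) * D) (+-comm R (M ^ suc e)) ⟩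
    M ^ suc e + R + (M ∸ x) * D      ≡⟨ +-assoc (M ^ suc e) R ((M ∸ x) * D) ⟩
    M ^ suc e + (R + (M ∸ x) * D)    <⟨ +-monoʳ-< (M ^ suc e)
                                          (+-mono-<-≤ (below-next-shell e M (m≤m⊔n a x) R<)
                                                      (*-monoˡ-≤ D (m∸n≤m M x))) ⟩
    M ^ suc e + (M ^ e + D + M * D)  ≡⟨ cong (M ^ suc e +_) (+-assoc (M ^ e) D (M * D)) ⟩
    M ^ suc e + (M ^ e + suc M * D)  ≡⟨ sym (shell-width M e) ⟩
    suc M ^ suc e                    ∎

encode-digit : ∀ e {a R} x → Shell (suc e) a R → let M = a ⊔ x; D = gap M (suc e) in
  divℕ (R + (M ∸ x) * D ∸ M ^ suc e) D ≡ M ∸ x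
encode-digit e {a} {R} x (R≥ , R<) = begin
  divℕ (R + (M ∸ x) * D ∸ M ^ suc e) D  ≡⟨ cong (λ t → divℕ t D) (shift digit-or-above) ⟩
  divℕ (R ∸ M ^ suc e + (M ∸ x) * D) D  ≡⟨ divℕ-exact _ (M ∸ x) D remainder< ⟩
  M ∸ x                                 ∎
  where
  open ≡-Reasoning
  M D : ℕ
  M = a ⊔ x
  D = gap M (suc e)
  remainder< : R ∸ M ^ suc e < D
  remainder< = ∸-<-bound (gap>0 M e) (below-next-shell (suc e) M (m≤m⊔n a x) R<)
  digit-or-above : M ∸ x ≡ 0 ⊎ M ^ suc e ≤ R
  digit-or-above with a ≤? x
  ... | yes a≤x = inj₁ (m≤n⇒m∸n≡0 (⊔-lub a≤x ≤-refl))
  ... | no  a≰x = inj₂ (≤-trans (^-monoˡ-≤ (suc e) (⊔-lub ≤-refl (≰⇒≥ a≰x))) R≥)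
  shift : ∀ {c} → c ≡ 0 ⊎ M ^ suc e ≤ R → R + c * D ∸ M ^ suc e ≡ R ∸ M ^ suc e + c * D
  shift (inj₁ refl) = trans (cong (_∸ M ^ suc e) (+-identityʳ R)) (sym (+-identityʳ _))
  shift (inj₂ P≤R)  = +-∸-comm _ P≤R

r-shell : ∀ n (v : Vec ℕ (suc n)) → Shell (suc n) (maxV v) (r n v)
r-shell zero (x ∷ []) rewrite ⊔-identityʳ x | *-identityʳ x = ≤-refl , n<1+n x
r-shell (suc n) = ∷ʳ-elim (λ v → Shell (suc (suc n)) (maxV v) (r (suc n) v)) λ u x →
  subst₂ (Shell (suc (suc n))) (sym (maxV-∷ʳ u x)) (sym (r-∷ʳ n u x)) (encode-shell (suc n) x (r-shell n u))

lastCoord : ℕ → ℕ → ℕ → ℕ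
lastCoord n z m = m ∸ divℕ (z ∸ m ^ suc (suc n) ∸ m ^ suc n) (gap m (suc n))

-- rinv (suc n) z is definitionally decodeStep n z (iroot (suc (suc n)) z)
decodeStep : ∀ n → ℕ → ℕ → Vec ℕ (suc (suc n))
decodeStep n z m = rinv n (z ∸ m ^ suc (suc n) ∸ (m ∸ lastCoord n z m) * gap m (suc n)) ∷ʳ lastCoord n z m

rinv∘r : ∀ n (v : Vec ℕ (suc n)) → rinv n (r n v) ≡ v
rinv∘r zero    (x ∷ []) = refl
rinv∘r (suc n) = ∷ʳ-elim (λ v → rinv (suc n) (r (suc n) v) ≡ v) decode-∷ʳ
  where
  decode-∷ʳ : ∀ u x → rinv (suc n) (r (suc n) (u ∷ʳ x)) ≡ u ∷ʳ x
  decode-∷ʳ u x = begin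
    rinv (suc n) (r (suc n) (u ∷ʳ x))  ≡⟨ cong (rinv (suc n)) (r-∷ʳ n u x) ⟩
    rinv (suc n) Z                     ≡⟨ cong (decodeStep n Z) root≡M ⟩
    decodeStep n Z M                   ≡⟨ cong₂ _∷ʳ_ prefix≡ last≡ ⟩
    u ∷ʳ x                             ∎
    where
    open ≡-Reasoning
    R M D K Z : ℕ
    R = r n u
    M = maxV u ⊔ x
    D = gap M (suc n)
    K = (M ∸ x) * D
    Z = R + M ^ suc (suc n) + K
    sh : Shell (suc n) (maxV u) R
    sh = r-shell n u
    root≡M : iroot (suc (suc n)) Z ≡ M
    root≡M = iroot-unique (suc n) (encode-shell (suc n) x sh)
    last≡ : lastCoord n Z M ≡ x
    last≡ = begin
      M ∸ divℕ (Z ∸ M ^ suc (suc n) ∸ M ^ suc n) D  ≡⟨ cong (λ t → M ∸ divℕ (t ∸ M ^ suc n) D)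
                                                          (cancel-middle R (M ^ suc (suc n)) K) ⟩
      M ∸ divℕ (R + K ∸ M ^ suc n) D                ≡⟨ cong (M ∸_) (encode-digit n x sh) ⟩
      M ∸ (M ∸ x)                                   ≡⟨ m∸[m∸n]≡n (m≤n⊔m (maxV u) x) ⟩
      x                                             ∎
    prefix≡ : rinv n (Z ∸ M ^ suc (suc n) ∸ (M ∸ lastCoord n Z M) * D) ≡ u
    prefix≡ = begin
      rinv n (Z ∸ M ^ suc (suc n) ∸ (M ∸ lastCoord n Z M) * D)
        ≡⟨ cong (λ c → rinv n (Z ∸ M ^ suc (suc n) ∸ (M ∸ c) * D)) last≡ ⟩
      rinv n (Z ∸ M ^ suc (suc n) ∸ K)
        ≡⟨ cong (λ t → rinv n (t ∸ K)) (cancel-middle R (M ^ suc (suc n)) K) ⟩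
      rinv n (R + K ∸ K)                                        ≡⟨ cong (rinv n) (m+n∸n≡m R K) ⟩
      rinv n R                                                  ≡⟨ rinv∘r n u ⟩
      u                                                         ∎

module Decoding (e z m : ℕ) (z∈shell : Shell (suc (suc e)) m z) where

  D : ℕ
  D = gap m (suc e)

  y : ℕ
  y = z ∸ m ^ suc (suc e)

  k : ℕ
  k = divℕ (y ∸ m ^ suc e) D

  -- z < (m+1)^(e+2) = m^(e+2) + m^(e+1) + (m+1)·g
  y< : y < m ^ suc e + suc m * D
  y< = +-cancelˡ-< (m ^ suc (suc e)) y _
         (subst₂ _<_ (sym (m+[n∸m]≡n (proj₁ z∈shell))) (shell-width m (suc e)) (proj₂ z∈shell))

  k≤m : k ≤ m
  k≤m = s≤s⁻¹ (divℕ-< (y ∸ m ^ suc e) D (suc m)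
                 (∸-<-bound {A = m ^ suc e} (≤-trans (gap>0 m e) (m≤m+n D (m * D))) y<))

  kD≤y : k * D ≤ y
  kD≤y = ≤-trans (divℕ-*≤ _ D) (m∸n≤m y (m ^ suc e))

  remainder< : y ∸ k * D < suc m ^ suc e
  remainder< = begin-strict
    y ∸ k * D                          ≤⟨ m≤n+m∸n (y ∸ k * D) (m ^ suc e) ⟩
    m ^ suc e + (y ∸ k * D ∸ m ^ suc e) ≡⟨ cong (m ^ suc e +_) ∸-swap ⟩
    m ^ suc e + (y ∸ m ^ suc e ∸ k * D) <⟨ +-monoʳ-< (m ^ suc e) (divℕ-remainder< _ D (gap>0 m e)) ⟩
    m ^ suc e + D                      ≡⟨ pow+gap m (suc e) ⟩
    suc m ^ suc e                      ∎
    where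
    open ≤-Reasoning
    ∸-swap : y ∸ k * D ∸ m ^ suc e ≡ y ∸ m ^ suc e ∸ k * D
    ∸-swap = trans (∸-+-assoc y (k * D) (m ^ suc e))
               (trans (cong (y ∸_) (+-comm (k * D) (m ^ suc e))) (sym (∸-+-assoc y (m ^ suc e) (k * D))))

  remainder≥ : k ≡ 0 ⊎ m ^ suc e ≤ y ∸ k * D
  remainder≥ with k ≟ 0
  ... | yes k≡0 = inj₁ k≡0
  ... | no  k≢0 = inj₂ (m+n≤o⇒m≤o∸n (m ^ suc e) (subst (_≤ y) (+-comm (k * D) _)
                         (m≤o∸n⇒m+n≤o (k * D) (<⇒≤ base<y) (divℕ-*≤ _ D))))
    where
    -- k ≥ 1 means y − m^(e+1) ≥ g > 0
    base<y : m ^ suc e < y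
    base<y = m∸n≢0⇒n<m (>⇒≢ (≤-trans (≤-trans (gap>0 m e) (m≤n*m D k {{≢-nonZero k≢0}})) (divℕ-*≤ _ D)))

  reassemble : y ∸ k * D + m ^ suc (suc e) + k * D ≡ z
  reassemble = begin
    y ∸ k * D + m ^ suc (suc e) + k * D    ≡⟨ +-assoc (y ∸ k * D) _ (k * D) ⟩
    y ∸ k * D + (m ^ suc (suc e) + k * D)  ≡⟨ cong (y ∸ k * D +_) (+-comm _ (k * D)) ⟩
    y ∸ k * D + (k * D + m ^ suc (suc e))  ≡⟨ sym (+-assoc (y ∸ k * D) (k * D) _) ⟩
    y ∸ k * D + k * D + m ^ suc (suc e)    ≡⟨ cong (_+ m ^ suc (suc e)) (m∸n+n≡m kD≤y) ⟩
    y + m ^ suc (suc e)                    ≡⟨ m∸n+n≡m (proj₁ z∈shell) ⟩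
    z                                      ∎
    where open ≡-Reasoning

max-lastCoord : ∀ {b m} k → b ≤ m → k ≡ 0 ⊎ m ≤ b → b ⊔ (m ∸ k) ≡ m
max-lastCoord k b≤m (inj₁ refl) = m≤n⇒m⊔n≡n b≤m
max-lastCoord {b} {m} k b≤m (inj₂ m≤b) with ≤-antisym b≤m m≤b
... | refl = m≥n⇒m⊔n≡m (m∸n≤m b k)

r∘rinv : ∀ n z → r n (rinv n z) ≡ z
r∘rinv zero    z = refl
r∘rinv (suc n) z = reencode (iroot (suc (suc n)) z) (iroot-shell (suc n) z)
  where
  reencode : ∀ m → Shell (suc (suc n)) m z → r (suc n) (decodeStep n z m) ≡ z
  reencode m sh = begin
    r (suc n) (w ∷ʳ (m ∸ k))                                     ≡⟨ r-∷ʳ n w (m ∸ k) ⟩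
    r n w + M ^ suc (suc n) + (M ∸ (m ∸ k)) * gap M (suc n)
      ≡⟨ cong (λ M′ → r n w + M′ ^ suc (suc n) + (M′ ∸ (m ∸ k)) * gap M′ (suc n)) M≡m ⟩
    r n w + m ^ suc (suc n) + (m ∸ (m ∸ k)) * D
      ≡⟨ cong₂ (λ a c → a + m ^ suc (suc n) + c * D) w-code (m∸[m∸n]≡n k≤m) ⟩
    y ∸ k * D + m ^ suc (suc n) + k * D                          ≡⟨ reassemble ⟩
    z                                                            ∎
    where
    open ≡-Reasoning
    open Decoding n z m sh
    w : Vec ℕ (suc n)
    w = rinv n (y ∸ (m ∸ (m ∸ k)) * D)
    M : ℕ
    M = maxV w ⊔ (m ∸ k)
    w-code : r n w ≡ y ∸ k * D
    w-code = trans (r∘rinv n _) (cong (λ c → y ∸ c * D) (m∸[m∸n]≡n k≤m))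
    w-shell : Shell (suc n) (maxV w) (y ∸ k * D)
    w-shell = subst (Shell (suc n) (maxV w)) w-code (r-shell n w)
    M≡m : M ≡ m
    M≡m = max-lastCoord k (shell-≤ (suc n) (proj₁ w-shell) remainder<)
                          (map₂ (λ base≤ → shell-≤ (suc n) base≤ (proj₂ w-shell)) remainder≥)

theorem17 : (n : ℕ) →
    ((v : Vec ℕ (suc n)) → rinv n (r n v) ≡ v) × ((z : ℕ) → r n (rinv n z) ≡ z)
theorem17 n = rinv∘r n , r∘rinv n
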